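{- For all integers $n,m\geq 0$, \begin{align*} \sum_{k=0}^{n}\binom{n}{k} Q_{m+k,m}\,(n-k)! &= \sum_{k=0}^{n}\binom{n}{k}I_{m+k}D_{n-k},\\ \sum_{k=0}^{n}\binom{n}{k}Q_{m+k,m}\,I_{n-k} &= \sum_{k=0}^{n}\binom{n}{k}I_{m+k}M_{n-k},\\ \sum_{k=0}^{n}\binom{n}{k} Q_{m+k,m}\,B_{n-k+1} &= \sum_{k=0}^{n}\binom{n}{k}I_{m+k}B_{n-k}. \end{align*}
   Context: An involution of a finite set is a permutation $\sigma$ with $\sigma^2=\mathrm{id}$. For $0\le k\le n$, $Q_{n,k}$ is the number of involutions of $[n+1]=\{1,\dots,n+1\}$ whose largest fixed point is $k+1$. $I_n$ is the number of involutions of $[n]$ ($I_0=1$); $M_n$ is the number of fixed-point-free involutions of $[n]$ ($M_0=1$); $D_n$ is the number of derangements (fixed-point-free permutations) of $[n]$ ($D_0=1$); $B_n$ is the $n$-th Bell number, the number of set partitions of $[n]$ ($B_0=1$). -}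

module Defs where

open import Data.Nat using (ℕ; zero; suc; _+_; _*_; _∸_; _<_)
open import Data.Nat using (_!)
open import Data.Nat.Combinatorics using (_C_)
open import Data.Bool using (Bool)
open import Data.Bool.Properties using () renaming (_≟_ to _≟ᵇ_)
open import Data.Fin using (Fin; _<?_) renaming (_<_ to _<ᶠ_)
open import Data.Fin.Properties using (all?; _≟_)
open import Data.List using (List; []; _∷_; map; concatMap; filter; length; upTo; allFin)
open import Data.Nat.ListAction using (sum)
open import Data.Vec using (Vec; []; _∷_; lookup)
open import Data.Product using (_×_; _,_)
open import Relation.Binary.PropositionalEquality using (_≡_)
open import Relation.Nullary using (Dec; ¬_; yes; no; _×-dec_; _→-dec_; ¬?)

allVecs : {A : Set} → List A → (k : ℕ) → List (Vec A k)
allVecs xs zero    = [] ∷ []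
allVecs xs (suc k) = concatMap (λ x → map (x ∷_) (allVecs xs k)) xs

-- all maps [n] → [n], a map f being encoded by its table (f 0, …, f (n-1))
allMaps : (n : ℕ) → List (Vec (Fin n) n)
allMaps n = allVecs (allFin n) n

allRels : (n : ℕ) → List (Vec (Vec Bool n) n)
allRels n = allVecs (allVecs (Bool.true ∷ Bool.false ∷ []) n) n

-- a map is a permutation of the finite set [n] iff it is injective
IsPerm : {n : ℕ} → Vec (Fin n) n → Set
IsPerm {n} f = (i j : Fin n) → lookup f i ≡ lookup f j → i ≡ j

isPerm? : {n : ℕ} (f : Vec (Fin n) n) → Dec (IsPerm f)
isPerm? f = all? λ i → all? λ j → (lookup f i ≟ lookup f j) →-dec (i ≟ j)

IsInvolution : {n : ℕ} → Vec (Fin n) n → Set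
IsInvolution {n} f = IsPerm f × ((i : Fin n) → lookup f (lookup f i) ≡ i)

isInvolution? : {n : ℕ} (f : Vec (Fin n) n) → Dec (IsInvolution f)
isInvolution? f = isPerm? f ×-dec all? λ i → lookup f (lookup f i) ≟ i

FixedPointFree : {n : ℕ} → Vec (Fin n) n → Set
FixedPointFree {n} f = (i : Fin n) → ¬ (lookup f i ≡ i)

fixedPointFree? : {n : ℕ} (f : Vec (Fin n) n) → Dec (FixedPointFree f)
fixedPointFree? f = all? λ i → ¬? (lookup f i ≟ i)

-- the largest fixed point of f is the element with (0-based) index k,
-- i.e. (1-based) the element k+1
LargestFixedPoint : {n : ℕ} → Vec (Fin n) n → Fin n → Set
LargestFixedPoint {n} f k = (lookup f k ≡ k) × ((j : Fin n) → k <ᶠ j → ¬ (lookup f j ≡ j))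

largestFixedPoint? : {n : ℕ} (f : Vec (Fin n) n) (k : Fin n) → Dec (LargestFixedPoint f k)
largestFixedPoint? f k = (lookup f k ≟ k) ×-dec all? λ j → (k <? j) →-dec ¬? (lookup f j ≟ j)

-- equivalence relations on [n]; these correspond bijectively to set partitions of [n]
IsEquivRel : {n : ℕ} → Vec (Vec Bool n) n → Set
IsEquivRel {n} r =
  ((i : Fin n) → R i i ≡ Bool.true) ×
  ((i j : Fin n) → R i j ≡ Bool.true → R j i ≡ Bool.true) ×
  ((i j l : Fin n) → R i j ≡ Bool.true → R j l ≡ Bool.true → R i l ≡ Bool.true)
  where R : Fin n → Fin n → Bool
        R i j = lookup (lookup r i) j

isEquivRel? : {n : ℕ} (r : Vec (Vec Bool n) n) → Dec (IsEquivRel r)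
isEquivRel? r =
  (all? λ i → R i i ≟ᵇ Bool.true) ×-dec
  ((all? λ i → all? λ j → (R i j ≟ᵇ Bool.true) →-dec (R j i ≟ᵇ Bool.true)) ×-dec
   (all? λ i → all? λ j → all? λ l →
      (R i j ≟ᵇ Bool.true) →-dec ((R j l ≟ᵇ Bool.true) →-dec (R i l ≟ᵇ Bool.true))))
  where R = λ i j → lookup (lookup r i) j

I : ℕ → ℕ
I n = length (filter isInvolution? (allMaps n))

M : ℕ → ℕ
M n = length (filter (λ f → isInvolution? f ×-dec fixedPointFree? f) (allMaps n))

D : ℕ → ℕ
D n = length (filter (λ f → isPerm? f ×-dec fixedPointFree? f) (allMaps n))

B : ℕ → ℕ
B n = length (filter isEquivRel? (allRels n))

-- Q n k : number of involutions of [n+1] whose largest fixed point is k+1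
-- (for k > n there is no such element; we return 0)
Q : ℕ → ℕ → ℕ
Q n k with k Data.Nat.<? suc n
... | yes k<n+1 = length (filter (λ f → isInvolution? f ×-dec largestFixedPoint? f (Data.Fin.fromℕ< k<n+1)) (allMaps (suc n)))
... | no _ = 0

sumTo : ℕ → (ℕ → ℕ) → ℕ
sumTo n f = sum (map f (upTo (suc n)))

-- Write (a ⋆ b) n = Σₖ (n C k) · a k · b (n ∸ k) for binomial convolution and 𝟏 for the
-- constant sequence 1. With q k = Q (m+k) m, each identity reads q ⋆ x = i ⋆ y where
-- i k = I (m+k) = (𝟏 ⋆ q) k and x = 𝟏 ⋆ y for (x, y) = (n!, D), (I, M), (B ∘ suc, B);
-- so it is the exchange law q ⋆ (𝟏 ⋆ y) = (𝟏 ⋆ q) ⋆ y, proved by induction from the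
-- Leibniz rule for ⋆.
--
-- The four recurrences i = 𝟏 ⋆ q and x = 𝟏 ⋆ y all come from arrays T N p obeying Pascal's
-- rule T (N+1) (p+1) = T (N+1) p + T N p, whose diagonal then satisfies
-- T (m+j) (m+j) = Σₖ (j C k) T (m+k) m. For permutations or involutions of [N], T N p counts
-- those without fixed points in [p, N); the rule splits on whether p is fixed and, if so,
-- deletes it, and deleting the largest fixed point m likewise gives Q (m+k) m = T (m+k) m.
-- For set partitions of [N+1], T N p counts those in which no point of [p, N) shares a
-- block with N; the rule splits on whether p does and, if so, merges p into N.

{-# OPTIONS --safe #-}
module Submission where

open import Data.Bool using (Bool; true; false)
open import Data.Bool.Properties using (¬-not; not-¬) renaming (_≟_ to _≟ᵇ_)
open import Data.Empty using (⊥-elim)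
open import Data.Fin using (Fin; toℕ; fromℕ; fromℕ<; punchIn; punchOut) renaming (zero to fzero; suc to fsuc)
open import Data.Fin.Properties
  using ( _≟_; all?; toℕ-injective; toℕ-fromℕ; toℕ-fromℕ<; toℕ<n
        ; punchIn-injective; punchInᵢ≢i; punchIn-punchOut; punchOut-punchIn; punchOut-cong)
open import Data.List using (List; []; _∷_; _++_; map; filter; length; applyUpTo; cartesianProductWith; concatMap)
open import Data.List.Properties using (length-map; filter-≐; filter-none)
open import Data.List.Membership.Propositional using (_∈_)
open import Data.List.Membership.Propositional.Properties
  using (∈-map⁺; ∈-map⁻; ∈-filter⁺; ∈-filter⁻; ∈-cartesianProductWith⁺; ∈-allFin)
open import Data.List.Membership.Propositional.Properties.WithK using (unique∧set⇒bag)
import Data.List.Relation.Unary.All as All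
open import Data.List.Relation.Unary.Any using (here; there)
open import Data.List.Relation.Unary.AllPairs using ([]; _∷_)
open import Data.List.Relation.Unary.Unique.Propositional using (Unique)
import Data.List.Relation.Unary.Unique.Propositional.Properties as Unique
open import Data.List.Relation.Binary.BagAndSetEquality using (∼bag⇒↭)
open import Data.List.Relation.Binary.Permutation.Propositional.Properties using (↭-length)
open import Data.Maybe using (Maybe; just; nothing; fromMaybe)
import Data.Nat as ℕ
open import Data.Nat using (ℕ; zero; suc; _+_; _*_; _∸_; _≤_; _<_; _≤?_; _<?_; z≤n; s≤s; _!)
open import Data.Nat.Combinatorics using (_C_; nCk+nC[k+1]≡[n+1]C[k+1]; k>n⇒nCk≡0)
open import Data.Nat.ListAction using (sum)
open import Data.Nat.Properties
  using ( +-comm; +-assoc; +-suc; +-identityʳ; *-distribˡ-+; *-distribʳ-+; +-∸-assoc; +-monoʳ-≤; m≤m+n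
        ; ≤-refl; ≤-reflexive; ≤-trans; <-irrefl; <-asym; <-≤-trans; ≤-<-trans; ≰⇒>; ≤∧≢⇒<; m≤n⇒m≤1+n; <⇒≤
        ; +-commutativeSemigroup)
open import Algebra.Properties.CommutativeSemigroup +-commutativeSemigroup using (interchange; x∙yz≈y∙xz; x∙yz≈yx∙z)
open import Data.Nat.Tactic.RingSolver using (solve-∀)
open import Data.Product using (∃; _×_; _,_; proj₁; proj₂)
open import Data.Vec using (Vec; []; _∷_; lookup; tabulate)
open import Data.Vec.Properties using (∷-injective; lookup∘tabulate; tabulate∘lookup; tabulate-cong)
open import Function using (_∘_; const; Injective; mk⇔)
open import Level using (0ℓ)
open import Relation.Nullary using (¬_; yes; no; _×-dec_; _→-dec_; ¬?)
open import Relation.Unary using (Pred; Decidable; _⊆_)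
open import Relation.Binary.PropositionalEquality
open import Defs

open ≡-Reasoning

sum< : ℕ → (ℕ → ℕ) → ℕ
sum< zero    f = 0
sum< (suc n) f = f 0 + sum< n (f ∘ suc)

sum-applyUpTo : ∀ n (f g : ℕ → ℕ) → sum (map f (applyUpTo g n)) ≡ sum< n (f ∘ g)
sum-applyUpTo zero    f g = refl
sum-applyUpTo (suc n) f g = cong (f (g 0) +_) (sum-applyUpTo n f (g ∘ suc))

sumTo≡sum< : ∀ n (f : ℕ → ℕ) → sumTo n f ≡ sum< (suc n) f
sumTo≡sum< n f = sum-applyUpTo (suc n) f (λ k → k)

sum<-cong : ∀ n {f g : ℕ → ℕ} → (∀ k → k < n → f k ≡ g k) → sum< n f ≡ sum< n g
sum<-cong zero    eq = refl
sum<-cong (suc n) eq = cong₂ _+_ (eq 0 (s≤s z≤n)) (sum<-cong n (λ k k<n → eq (suc k) (s≤s k<n)))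

sum<-distrib-+ : ∀ n (f g : ℕ → ℕ) → sum< n (λ k → f k + g k) ≡ sum< n f + sum< n g
sum<-distrib-+ zero    f g = refl
sum<-distrib-+ (suc n) f g = begin
  f 0 + g 0 + sum< n (λ k → f (suc k) + g (suc k))
    ≡⟨ cong (f 0 + g 0 +_) (sum<-distrib-+ n (f ∘ suc) (g ∘ suc)) ⟩
  f 0 + g 0 + (sum< n (f ∘ suc) + sum< n (g ∘ suc))
    ≡⟨ interchange (f 0) (g 0) _ _ ⟩
  f 0 + sum< n (f ∘ suc) + (g 0 + sum< n (g ∘ suc)) ∎

sum<-suc : ∀ n (f : ℕ → ℕ) → sum< (suc n) f ≡ sum< n f + f n
sum<-suc zero    f = +-comm (f 0) 0
sum<-suc (suc n) f = trans (cong (f 0 +_) (sum<-suc n (f ∘ suc))) (sym (+-assoc (f 0) _ _))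

infixl 7 _⋆_

_⋆_ : (ℕ → ℕ) → (ℕ → ℕ) → ℕ → ℕ
(a ⋆ b) n = sum< (suc n) (λ k → (n C k) * a k * b (n ∸ k))

⋆-cong : ∀ {a a′ b b′ : ℕ → ℕ} → a ≗ a′ → b ≗ b′ → a ⋆ b ≗ a′ ⋆ b′
⋆-cong a≗a′ b≗b′ n = sum<-cong (suc n) λ k _ → cong₂ (λ u v → (n C k) * u * v) (a≗a′ k) (b≗b′ (n ∸ k))

⋆-congˡ : ∀ {a a′ : ℕ → ℕ} b → a ≗ a′ → a ⋆ b ≗ a′ ⋆ b
⋆-congˡ b a≗a′ = ⋆-cong a≗a′ (λ _ → refl)

⋆-congʳ : ∀ a {b b′ : ℕ → ℕ} → b ≗ b′ → a ⋆ b ≗ a ⋆ b′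
⋆-congʳ a = ⋆-cong {a} (λ _ → refl)

⋆-distribˡ-+ : ∀ (a b c : ℕ → ℕ) → a ⋆ (λ j → b j + c j) ≗ λ n → (a ⋆ b) n + (a ⋆ c) n
⋆-distribˡ-+ a b c n =
  trans (sum<-cong (suc n) λ k _ → *-distribˡ-+ ((n C k) * a k) (b (n ∸ k)) (c (n ∸ k)))
        (sum<-distrib-+ (suc n) (λ k → (n C k) * a k * b (n ∸ k)) (λ k → (n C k) * a k * c (n ∸ k)))

⋆-distribʳ-+ : ∀ (a b c : ℕ → ℕ) → (λ j → a j + b j) ⋆ c ≗ λ n → (a ⋆ c) n + (b ⋆ c) n
⋆-distribʳ-+ a b c n =
  trans (sum<-cong (suc n) λ k _ → trans (cong (_* c (n ∸ k)) (*-distribˡ-+ (n C k) (a k) (b k)))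
                                          (*-distribʳ-+ (c (n ∸ k)) ((n C k) * a k) ((n C k) * b k)))
        (sum<-distrib-+ (suc n) (λ k → (n C k) * a k * c (n ∸ k)) (λ k → (n C k) * b k * c (n ∸ k)))

-- Leibniz rule: Pascal's rule splits each coefficient of (n+1 C k+1).
⋆-suc : ∀ (a b : ℕ → ℕ) n → (a ⋆ b) (suc n) ≡ (a ∘ suc ⋆ b) n + (a ⋆ b ∘ suc) n
⋆-suc a b n = begin
  (a ⋆ b) (suc n)
    ≡⟨ cong (1 * a 0 * b (suc n) +_) (trans (sum<-cong (suc n) λ k _ → pascal k)
                                        (sum<-distrib-+ (suc n) lower upper)) ⟩
  1 * a 0 * b (suc n) + ((a ∘ suc ⋆ b) n + sum< (suc n) upper)
    ≡⟨ cong (λ z → 1 * a 0 * b (suc n) + ((a ∘ suc ⋆ b) n + z)) upper-top ⟩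
  1 * a 0 * b (suc n) + ((a ∘ suc ⋆ b) n + sum< n upper)
    ≡⟨ x∙yz≈y∙xz (1 * a 0 * b (suc n)) ((a ∘ suc ⋆ b) n) (sum< n upper) ⟩
  (a ∘ suc ⋆ b) n + (1 * a 0 * b (suc n) + sum< n upper)
    ≡⟨ cong (λ z → (a ∘ suc ⋆ b) n + (1 * a 0 * b (suc n) + z)) (sum<-cong n shift) ⟩
  (a ∘ suc ⋆ b) n + (a ⋆ b ∘ suc) n ∎
  where
  lower upper : ℕ → ℕ
  lower k = (n C k) * a (suc k) * b (n ∸ k)
  upper k = (n C suc k) * a (suc k) * b (n ∸ k)

  pascal : ∀ k → (suc n C suc k) * a (suc k) * b (n ∸ k) ≡ lower k + upper k
  pascal k = begin
    (suc n C suc k) * a (suc k) * b (n ∸ k)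
      ≡⟨ cong (λ c → c * a (suc k) * b (n ∸ k)) (sym (nCk+nC[k+1]≡[n+1]C[k+1] n k)) ⟩
    ((n C k) + (n C suc k)) * a (suc k) * b (n ∸ k)
      ≡⟨ cong (_* b (n ∸ k)) (*-distribʳ-+ (a (suc k)) (n C k) (n C suc k)) ⟩
    ((n C k) * a (suc k) + (n C suc k) * a (suc k)) * b (n ∸ k)
      ≡⟨ *-distribʳ-+ (b (n ∸ k)) ((n C k) * a (suc k)) ((n C suc k) * a (suc k)) ⟩
    lower k + upper k ∎

  upper-top : sum< (suc n) upper ≡ sum< n upper
  upper-top = begin
    sum< (suc n) upper
      ≡⟨ sum<-suc n upper ⟩
    sum< n upper + (n C suc n) * a (suc n) * b (n ∸ n)
      ≡⟨ cong (λ c → sum< n upper + c * a (suc n) * b (n ∸ n)) (k>n⇒nCk≡0 {n} ≤-refl) ⟩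
    sum< n upper + 0
      ≡⟨ +-identityʳ _ ⟩
    sum< n upper ∎

  shift : ∀ k → k < n → upper k ≡ (n C suc k) * a (suc k) * b (suc (n ∸ suc k))
  shift k k<n = cong (λ i → (n C suc k) * a (suc k) * b i) (+-∸-assoc 1 k<n)

𝟏 : ℕ → ℕ
𝟏 = const 1

𝟏⋆-suc : ∀ (a : ℕ → ℕ) n → (𝟏 ⋆ a) (suc n) ≡ (𝟏 ⋆ a) n + (𝟏 ⋆ a ∘ suc) n
𝟏⋆-suc = ⋆-suc 𝟏

⋆-exchange : ∀ (a y : ℕ → ℕ) → a ⋆ (𝟏 ⋆ y) ≗ (𝟏 ⋆ a) ⋆ y
⋆-exchange a y zero = cong (_+ 0) (base (a 0) (y 0))
  where base : ∀ u v → 1 * u * (1 * 1 * v + 0) ≡ 1 * (1 * 1 * u + 0) * v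
        base = solve-∀
⋆-exchange a y (suc n) = begin
  (a ⋆ (𝟏 ⋆ y)) (suc n)
    ≡⟨ ⋆-suc a (𝟏 ⋆ y) n ⟩
  (a ∘ suc ⋆ (𝟏 ⋆ y)) n + (a ⋆ (𝟏 ⋆ y) ∘ suc) n
    ≡⟨ cong ((a ∘ suc ⋆ (𝟏 ⋆ y)) n +_)
            (trans (⋆-congʳ a (𝟏⋆-suc y) n) (⋆-distribˡ-+ a (𝟏 ⋆ y) (𝟏 ⋆ y ∘ suc) n)) ⟩
  (a ∘ suc ⋆ (𝟏 ⋆ y)) n + ((a ⋆ (𝟏 ⋆ y)) n + (a ⋆ (𝟏 ⋆ y ∘ suc)) n)
    ≡⟨ cong₂ _+_ (⋆-exchange (a ∘ suc) y n) (cong₂ _+_ (⋆-exchange a y n) (⋆-exchange a (y ∘ suc) n)) ⟩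
  ((𝟏 ⋆ a ∘ suc) ⋆ y) n + (((𝟏 ⋆ a) ⋆ y) n + ((𝟏 ⋆ a) ⋆ y ∘ suc) n)
    ≡⟨ x∙yz≈yx∙z (((𝟏 ⋆ a ∘ suc) ⋆ y) n) (((𝟏 ⋆ a) ⋆ y) n) (((𝟏 ⋆ a) ⋆ y ∘ suc) n) ⟩
  ((𝟏 ⋆ a) ⋆ y) n + ((𝟏 ⋆ a ∘ suc) ⋆ y) n + ((𝟏 ⋆ a) ⋆ y ∘ suc) n
    ≡⟨ cong (_+ ((𝟏 ⋆ a) ⋆ y ∘ suc) n)
            (sym (trans (⋆-congˡ y (𝟏⋆-suc a) n) (⋆-distribʳ-+ (𝟏 ⋆ a) (𝟏 ⋆ a ∘ suc) y n))) ⟩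
  ((𝟏 ⋆ a) ∘ suc ⋆ y) n + ((𝟏 ⋆ a) ⋆ y ∘ suc) n
    ≡⟨ sym (⋆-suc (𝟏 ⋆ a) y n) ⟩
  ((𝟏 ⋆ a) ⋆ y) (suc n) ∎

𝟏⋆-solves-recurrence : (V : ℕ → ℕ → ℕ) → (∀ j k → V (suc j) k ≡ V j (suc k) + V j k) →
  ∀ j k → V j k ≡ (𝟏 ⋆ λ i → V 0 (k + i)) j
𝟏⋆-solves-recurrence V rec zero k = trans (cong (V 0) (sym (+-identityʳ k))) (base (V 0 (k + 0)))
  where base : ∀ u → u ≡ 1 * 1 * u + 0
        base = solve-∀
𝟏⋆-solves-recurrence V rec (suc j) k = begin
  V (suc j) k
    ≡⟨ rec j k ⟩
  V j (suc k) + V j k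
    ≡⟨ cong₂ _+_ (𝟏⋆-solves-recurrence V rec j (suc k)) (𝟏⋆-solves-recurrence V rec j k) ⟩
  (𝟏 ⋆ row (suc k)) j + (𝟏 ⋆ row k) j
    ≡⟨ +-comm _ ((𝟏 ⋆ row k) j) ⟩
  (𝟏 ⋆ row k) j + (𝟏 ⋆ row (suc k)) j
    ≡⟨ cong ((𝟏 ⋆ row k) j +_) (⋆-congʳ 𝟏 (λ i → cong (V 0) (sym (+-suc k i))) j) ⟩
  (𝟏 ⋆ row k) j + (𝟏 ⋆ row k ∘ suc) j
    ≡⟨ 𝟏⋆-suc (row k) j ⟨
  (𝟏 ⋆ row k) (suc j) ∎
  where row : ℕ → ℕ → ℕ
        row k i = V 0 (k + i)

PascalRecurrence : (ℕ → ℕ → ℕ) → Set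
PascalRecurrence T = ∀ N p → p ≤ N → T (suc N) (suc p) ≡ T (suc N) p + T N p

diagonal≡𝟏⋆column : ∀ T → PascalRecurrence T → ∀ m j → T (m + j) (m + j) ≡ (𝟏 ⋆ λ k → T (m + k) m) j
diagonal≡𝟏⋆column T rec m j = begin
  T (m + j) (m + j)               ≡⟨ cong (λ i → T (m + i) (m + j)) (sym (+-identityʳ j)) ⟩
  V j 0                           ≡⟨ 𝟏⋆-solves-recurrence V recV j 0 ⟩
  (𝟏 ⋆ V 0) j                     ≡⟨ ⋆-congʳ 𝟏 (λ k → cong (T (m + k)) (+-identityʳ m)) j ⟩
  (𝟏 ⋆ λ k → T (m + k) m) j       ∎
  where
  V : ℕ → ℕ → ℕ
  V j k = T (m + (j + k)) (m + j)
  recV : ∀ j k → V (suc j) k ≡ V j (suc k) + V j k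
  recV j k = begin
    T (m + suc (j + k)) (m + suc j)
      ≡⟨ cong₂ T (+-suc m (j + k)) (+-suc m j) ⟩
    T (suc (m + (j + k))) (suc (m + j))
      ≡⟨ rec (m + (j + k)) (m + j) (+-monoʳ-≤ m (m≤m+n j k)) ⟩
    T (suc (m + (j + k))) (m + j) + T (m + (j + k)) (m + j)
      ≡⟨ cong (λ N → T N (m + j) + V j k) (trans (cong (m +_) (+-suc j k)) (+-suc m (j + k))) ⟨
    V j (suc k) + V j k ∎

count : {A : Set} {P : Pred A 0ℓ} → Decidable P → List A → ℕ
count P? xs = length (filter P? xs)

record IsEnumeration {A : Set} (xs : List A) : Set where
  field
    complete : ∀ x → x ∈ xs
    unique   : Unique xs

open IsEnumeration

count-≐ : {A : Set} {P Q : Pred A 0ℓ} (P? : Decidable P) (Q? : Decidable Q) →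
  P ⊆ Q → Q ⊆ P → ∀ xs → count P? xs ≡ count Q? xs
count-≐ P? Q? P⊆Q Q⊆P xs = cong length (filter-≐ P? Q? (P⊆Q , Q⊆P) xs)

count-none : {A : Set} {P : Pred A 0ℓ} (P? : Decidable P) → (∀ x → ¬ P x) → ∀ xs → count P? xs ≡ 0
count-none P? ¬P xs = cong length (filter-none P? (All.universal ¬P xs))

count-split : {A : Set} {P R : Pred A 0ℓ} (P? : Decidable P) (R? : Decidable R) → ∀ xs →
  count P? xs ≡ count (λ x → P? x ×-dec R? x) xs + count (λ x → P? x ×-dec ¬? (R? x)) xs
count-split P? R? [] = refl
count-split P? R? (x ∷ xs) with P? x | R? x
... | yes _ | yes _ = cong suc (count-split P? R? xs)
... | yes _ | no  _ = trans (cong suc (count-split P? R? xs)) (sym (+-suc _ _))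
... | no  _ | _     = count-split P? R? xs

-- φ maps the P-part of xs onto the Q-part of ys; both lists are duplicate-free with the same
-- members, hence permutations of each other.
count-bijection : {A B : Set} {P : Pred A 0ℓ} {Q : Pred B 0ℓ} (P? : Decidable P) (Q? : Decidable Q)
  {xs : List A} {ys : List B} → IsEnumeration xs → IsEnumeration ys →
  (φ : A → B) → Injective _≡_ _≡_ φ →
  (∀ a → P a → Q (φ a)) → (∀ b → Q b → ∃ λ a → P a × φ a ≡ b) →
  count P? xs ≡ count Q? ys
count-bijection P? Q? {xs} {ys} enumA enumB φ φ-injective P⇒Q Q⇒P =
  trans (sym (length-map φ (filter P? xs)))
        (↭-length (∼bag⇒↭ (unique∧set⇒bag
          (Unique.map⁺ φ-injective (Unique.filter⁺ P? {xs} (unique enumA)))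
          (Unique.filter⁺ Q? {ys} (unique enumB))
          (mk⇔ to from))))
  where
  to : ∀ {b} → b ∈ map φ (filter P? xs) → b ∈ filter Q? ys
  to b∈ with a , a∈ , refl ← ∈-map⁻ φ b∈ =
    ∈-filter⁺ Q? (complete enumB _) (P⇒Q a (proj₂ (∈-filter⁻ P? {xs = xs} a∈)))
  from : ∀ {b} → b ∈ filter Q? ys → b ∈ map φ (filter P? xs)
  from b∈ with a , Pa , refl ← Q⇒P _ (proj₂ (∈-filter⁻ Q? {xs = ys} b∈)) =
    ∈-map⁺ φ (∈-filter⁺ P? (complete enumA a) Pa)

concatMap-map≡cartesianProductWith : {A B C : Set} (f : A → B → C) (xs : List A) (ys : List B) →
  concatMap (λ x → map (f x) ys) xs ≡ cartesianProductWith f xs ys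
concatMap-map≡cartesianProductWith f []       ys = refl
concatMap-map≡cartesianProductWith f (x ∷ xs) ys = cong (map (f x) ys ++_) (concatMap-map≡cartesianProductWith f xs ys)

allVecs-isEnumeration : {A : Set} {xs : List A} → IsEnumeration xs → ∀ k → IsEnumeration (allVecs xs k)
allVecs-isEnumeration enum zero = record { complete = λ { [] → here refl } ; unique = All.[] ∷ [] }
allVecs-isEnumeration {xs = xs} enum (suc k) = subst IsEnumeration
  (sym (concatMap-map≡cartesianProductWith _∷_ xs (allVecs xs k)))
  (record
    { complete = λ { (x ∷ v) → ∈-cartesianProductWith⁺ _∷_ (complete enum x) (complete tails v) }
    ; unique   = Unique.cartesianProductWith⁺ _∷_ ∷-injective (unique enum) (unique tails) })
  where
  tails : IsEnumeration (allVecs xs k)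
  tails = allVecs-isEnumeration enum k

allMaps-isEnumeration : ∀ n → IsEnumeration (allMaps n)
allMaps-isEnumeration n = allVecs-isEnumeration (record { complete = ∈-allFin ; unique = Unique.allFin⁺ n }) n

allRels-isEnumeration : ∀ n → IsEnumeration (allRels n)
allRels-isEnumeration n = allVecs-isEnumeration (allVecs-isEnumeration booleans n) n
  where
  booleans : IsEnumeration (true ∷ false ∷ [])
  booleans = record { complete = λ { true → here refl ; false → there (here refl) }
                    ; unique = ((λ ()) All.∷ All.[]) ∷ All.[] ∷ [] }

lookup-ext : {A : Set} {n : ℕ} {u v : Vec A n} → (∀ i → lookup u i ≡ lookup v i) → u ≡ v
lookup-ext {u = u} {v} eq = trans (sym (tabulate∘lookup u)) (trans (tabulate-cong eq) (tabulate∘lookup v))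

toℕ-punchIn-< : {n : ℕ} (p : Fin (suc n)) (i : Fin n) → toℕ i < toℕ p → toℕ (punchIn p i) ≡ toℕ i
toℕ-punchIn-< (fsuc p) fzero    _         = refl
toℕ-punchIn-< (fsuc p) (fsuc i) (s≤s i<p) = cong suc (toℕ-punchIn-< p i i<p)

toℕ-punchIn-≥ : {n : ℕ} (p : Fin (suc n)) (i : Fin n) → toℕ p ≤ toℕ i → toℕ (punchIn p i) ≡ suc (toℕ i)
toℕ-punchIn-≥ fzero    i        _         = refl
toℕ-punchIn-≥ (fsuc p) (fsuc i) (s≤s p≤i) = cong suc (toℕ-punchIn-≥ p i p≤i)

data PunchView {n : ℕ} (p : Fin (suc n)) : Fin (suc n) → Set where
  at     : PunchView p p
  beside : (i : Fin n) → PunchView p (punchIn p i)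

punchView : {n : ℕ} (p j : Fin (suc n)) → PunchView p j
punchView p j with p ≟ j
... | yes refl = at
... | no  p≢j  = subst (PunchView p) (punchIn-punchOut p≢j) (beside (punchOut p≢j))

module _ {N : ℕ} (p q : Fin (suc N)) where

  extend-value : Vec (Fin N) N → Fin (suc N) → Fin (suc N)
  extend-value g j with p ≟ j
  ... | yes _   = q
  ... | no  p≢j = punchIn q (lookup g (punchOut p≢j))

  extend : Vec (Fin N) N → Vec (Fin (suc N)) (suc N)
  extend g = tabulate (extend-value g)

  -- The value i in the first clause is junk: it is never used when f is a permutation with f p = q.
  restrict-value : Vec (Fin (suc N)) (suc N) → Fin N → Fin N
  restrict-value f i with q ≟ lookup f (punchIn p i)
  ... | yes _   = i
  ... | no  q≢j = punchOut q≢j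

  restrict : Vec (Fin (suc N)) (suc N) → Vec (Fin N) N
  restrict f = tabulate (restrict-value f)

  lookup-extend-at : ∀ g → lookup (extend g) p ≡ q
  lookup-extend-at g rewrite lookup∘tabulate (extend-value g) p with p ≟ p
  ... | yes _   = refl
  ... | no  p≢p = ⊥-elim (p≢p refl)

  lookup-extend-punchIn : ∀ g i → lookup (extend g) (punchIn p i) ≡ punchIn q (lookup g i)
  lookup-extend-punchIn g i rewrite lookup∘tabulate (extend-value g) (punchIn p i) with p ≟ punchIn p i
  ... | yes p≡ = ⊥-elim (punchInᵢ≢i p i (sym p≡))
  ... | no  p≢ = cong (λ j → punchIn q (lookup g j)) (trans (punchOut-cong p refl) (punchOut-punchIn p))

  extend-injective : ∀ {g g′} → extend g ≡ extend g′ → g ≡ g′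
  extend-injective {g} {g′} eq = lookup-ext λ i → punchIn-injective q _ _ (begin
    punchIn q (lookup g i)         ≡⟨ lookup-extend-punchIn g i ⟨
    lookup (extend g) (punchIn p i)  ≡⟨ cong (λ f → lookup f (punchIn p i)) eq ⟩
    lookup (extend g′) (punchIn p i) ≡⟨ lookup-extend-punchIn g′ i ⟩
    punchIn q (lookup g′ i)        ∎)

  extend-restrict : ∀ f → IsPerm f → lookup f p ≡ q → extend (restrict f) ≡ f
  extend-restrict f f-perm fp≡q = lookup-ext agree
    where
    agree : ∀ j → lookup (extend (restrict f)) j ≡ lookup f j
    agree j with punchView p j
    ... | at = trans (lookup-extend-at (restrict f)) (sym fp≡q)
    ... | beside i rewrite lookup-extend-punchIn (restrict f) i | lookup∘tabulate (restrict-value f) i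
                     with q ≟ lookup f (punchIn p i)
    ...   | yes q≡ = ⊥-elim (punchInᵢ≢i p i (sym (f-perm p (punchIn p i) (trans fp≡q q≡))))
    ...   | no  q≢ = punchIn-punchOut q≢

  extend-preserves-perm : ∀ g → IsPerm g → IsPerm (extend g)
  extend-preserves-perm g g-perm i j eq with punchView p i | punchView p j
  ... | at       | at       = refl
  ... | at       | beside j′ =
    ⊥-elim (punchInᵢ≢i q _ (sym (trans (sym (lookup-extend-at g)) (trans eq (lookup-extend-punchIn g j′)))))
  ... | beside i′ | at       =
    ⊥-elim (punchInᵢ≢i q _ (trans (sym (lookup-extend-punchIn g i′)) (trans eq (lookup-extend-at g))))
  ... | beside i′ | beside j′ = cong (punchIn p) (g-perm i′ j′ (punchIn-injective q _ _
          (trans (sym (lookup-extend-punchIn g i′)) (trans eq (lookup-extend-punchIn g j′)))))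

  extend-reflects-perm : ∀ g → IsPerm (extend g) → IsPerm g
  extend-reflects-perm g f-perm i j eq = punchIn-injective p i j (f-perm (punchIn p i) (punchIn p j)
    (trans (lookup-extend-punchIn g i) (trans (cong (punchIn q) eq) (sym (lookup-extend-punchIn g j)))))

module _ {N : ℕ} (p : Fin (suc N)) where

  extend-preserves-involution : ∀ g → IsInvolution g → IsInvolution (extend p p g)
  extend-preserves-involution g (g-perm , g-inv) = extend-preserves-perm p p g g-perm , square
    where
    f : Vec (Fin (suc N)) (suc N)
    f = extend p p g
    square : ∀ j → lookup f (lookup f j) ≡ j
    square j with punchView p j
    ... | at       = trans (cong (lookup f) (lookup-extend-at p p g)) (lookup-extend-at p p g)
    ... | beside i = begin
      lookup f (lookup f (punchIn p i))        ≡⟨ cong (lookup f) (lookup-extend-punchIn p p g i) ⟩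
      lookup f (punchIn p (lookup g i))        ≡⟨ lookup-extend-punchIn p p g (lookup g i) ⟩
      punchIn p (lookup g (lookup g i))        ≡⟨ cong (punchIn p) (g-inv i) ⟩
      punchIn p i                              ∎

  extend-reflects-involution : ∀ g → IsInvolution (extend p p g) → IsInvolution g
  extend-reflects-involution g (f-perm , f-inv) = extend-reflects-perm p p g f-perm , square
    where
    f : Vec (Fin (suc N)) (suc N)
    f = extend p p g
    square : ∀ i → lookup g (lookup g i) ≡ i
    square i = punchIn-injective p _ _ (begin
      punchIn p (lookup g (lookup g i))        ≡⟨ lookup-extend-punchIn p p g (lookup g i) ⟨
      lookup f (punchIn p (lookup g i))        ≡⟨ cong (lookup f) (lookup-extend-punchIn p p g i) ⟨
      lookup f (lookup f (punchIn p i))        ≡⟨ f-inv (punchIn p i) ⟩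
      punchIn p i                              ∎)

NoFixedPointFrom : {n : ℕ} → ℕ → Vec (Fin n) n → Set
NoFixedPointFrom p f = ∀ i → p ≤ toℕ i → ¬ lookup f i ≡ i

noFixedPointFrom? : {n : ℕ} (p : ℕ) → Decidable (NoFixedPointFrom {n} p)
noFixedPointFrom? p f = all? λ i → (p ≤? toℕ i) →-dec ¬? (lookup f i ≟ i)

record ExtensionClosed (𝒞 : ∀ {n} → Vec (Fin n) n → Set) : Set₁ where
  field
    𝒞?         : ∀ {n} → Decidable (𝒞 {n})
    𝒞⇒perm     : ∀ {n} {f : Vec (Fin n) n} → 𝒞 f → IsPerm f
    𝒞-extend⁺  : ∀ {N} (p : Fin (suc N)) g → 𝒞 g → 𝒞 (extend p p g)
    𝒞-extend⁻  : ∀ {N} (p : Fin (suc N)) g → 𝒞 (extend p p g) → 𝒞 g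

module FixedPointCounts {𝒞 : ∀ {n} → Vec (Fin n) n → Set} (closed : ExtensionClosed 𝒞) where
  open ExtensionClosed closed

  tailFree : ℕ → ℕ → ℕ
  tailFree N p = count (λ f → 𝒞? f ×-dec noFixedPointFrom? p f) (allMaps N)

  -- Removing the largest fixed point p leaves a map with no fixed point at or above p.
  largestFixedPoint-count : ∀ {N} (p : Fin (suc N)) →
    count (λ f → 𝒞? f ×-dec largestFixedPoint? f p) (allMaps (suc N)) ≡ tailFree N (toℕ p)
  largestFixedPoint-count {N} p = sym (count-bijection _ _ (allMaps-isEnumeration N) (allMaps-isEnumeration (suc N))
    (extend p p) (extend-injective p p) forward backward)
    where
    forward : ∀ g → 𝒞 g × NoFixedPointFrom (toℕ p) g → 𝒞 (extend p p g) × LargestFixedPoint (extend p p g) p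
    forward g (𝒞g , free) = 𝒞-extend⁺ p g 𝒞g , lookup-extend-at p p g , above
      where
      above : ∀ j → toℕ p ℕ.< toℕ j → ¬ lookup (extend p p g) j ≡ j
      above j p<j fixed with punchView p j
      ... | at       = <-irrefl refl p<j
      ... | beside i with toℕ p ≤? toℕ i
      ...   | yes p≤i = free i p≤i (punchIn-injective p _ _ (trans (sym (lookup-extend-punchIn p p g i)) fixed))
      ...   | no  p≰i = <-asym (subst (toℕ p ℕ.<_) (toℕ-punchIn-< p i (≰⇒> p≰i)) p<j) (≰⇒> p≰i)
    backward : ∀ f → 𝒞 f × LargestFixedPoint f p → ∃ λ g → (𝒞 g × NoFixedPointFrom (toℕ p) g) × extend p p g ≡ f
    backward f (𝒞f , fixed , above) = g , (𝒞-extend⁻ p g (subst 𝒞 (sym f≡) 𝒞f) , free) , f≡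
      where
      g : Vec (Fin N) N
      g = restrict p p f
      f≡ : extend p p g ≡ f
      f≡ = extend-restrict p p f (𝒞⇒perm 𝒞f) fixed
      free : NoFixedPointFrom (toℕ p) g
      free i p≤i gi≡i = above (punchIn p i) (≤-trans (s≤s p≤i) (≤-reflexive (sym (toℕ-punchIn-≥ p i p≤i))))
        (trans (cong (λ h → lookup h (punchIn p i)) (sym f≡)) (trans (lookup-extend-punchIn p p g i) (cong (punchIn p) gi≡i)))

  tailFree-suc : ∀ {N} (p : Fin (suc N)) →
    tailFree (suc N) (suc (toℕ p)) ≡ tailFree (suc N) (toℕ p) + tailFree N (toℕ p)
  tailFree-suc {N} p = trans (count-split _ (λ f → lookup f p ≟ p) (allMaps (suc N)))
    (trans (cong₂ _+_ p-fixed p-unfixed) (+-comm (tailFree N (toℕ p)) _))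
    where
    p-fixed : count (λ f → (𝒞? f ×-dec noFixedPointFrom? (suc (toℕ p)) f) ×-dec (lookup f p ≟ p)) (allMaps (suc N))
              ≡ tailFree N (toℕ p)
    p-fixed = trans (count-≐ _ (λ f → 𝒞? f ×-dec largestFixedPoint? f p)
                      (λ ((𝒞f , free) , fixed) → 𝒞f , fixed , free)
                      (λ (𝒞f , fixed , free) → (𝒞f , free) , fixed) (allMaps (suc N)))
                    (largestFixedPoint-count p)
    free-from-p : ∀ {f : Vec (Fin (suc N)) (suc N)} → NoFixedPointFrom (suc (toℕ p)) f → ¬ lookup f p ≡ p →
                  NoFixedPointFrom (toℕ p) f
    free-from-p free unfixed i p≤i with toℕ i ℕ.≟ toℕ p
    ... | yes i≡p rewrite toℕ-injective i≡p = unfixed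
    ... | no  i≢p = free i (≤∧≢⇒< p≤i (i≢p ∘ sym))
    p-unfixed : count (λ f → (𝒞? f ×-dec noFixedPointFrom? (suc (toℕ p)) f) ×-dec ¬? (lookup f p ≟ p)) (allMaps (suc N))
                ≡ tailFree (suc N) (toℕ p)
    p-unfixed = count-≐ _ _ (λ {f} ((𝒞f , free) , unfixed) → 𝒞f , free-from-p {f} free unfixed)
                            (λ (𝒞f , free) → (𝒞f , (λ i p<i → free i (<⇒≤ p<i))) , free p ≤-refl)
                            (allMaps (suc N))

  tailFree-pascal : PascalRecurrence tailFree
  tailFree-pascal N p p≤N =
    subst (λ k → tailFree (suc N) (suc k) ≡ tailFree (suc N) k + tailFree N k)
          (toℕ-fromℕ< (s≤s p≤N)) (tailFree-suc (fromℕ< (s≤s p≤N)))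

  tailFree-diagonal : ∀ N → tailFree N N ≡ count 𝒞? (allMaps N)
  tailFree-diagonal N =
    count-≐ _ _ proj₁ (λ 𝒞f → 𝒞f , λ i N≤i → ⊥-elim (<-irrefl refl (<-≤-trans (toℕ<n i) N≤i))) (allMaps N)

  tailFree-zero : ∀ N → tailFree N 0 ≡ count (λ f → 𝒞? f ×-dec fixedPointFree? f) (allMaps N)
  tailFree-zero N = count-≐ _ _ (λ (𝒞f , free) → 𝒞f , λ i → free i z≤n) (λ (𝒞f , free) → 𝒞f , λ i _ → free i)
                             (allMaps N)

permutations-with-head : ∀ {N} (q : Fin (suc N)) →
  count (λ f → isPerm? f ×-dec (lookup f fzero ≟ q)) (allMaps (suc N)) ≡ count isPerm? (allMaps N)
permutations-with-head {N} q = sym (count-bijection _ _ (allMaps-isEnumeration N) (allMaps-isEnumeration (suc N))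
  (extend fzero q) (extend-injective fzero q)
  (λ g g-perm → extend-preserves-perm fzero q g g-perm , lookup-extend-at fzero q g)
  (λ f (f-perm , f0≡q) → let f≡ = extend-restrict fzero q f f-perm f0≡q in
     restrict fzero q f , extend-reflects-perm fzero q (restrict fzero q f) (subst IsPerm (sym f≡) f-perm) , f≡))

permutations-with-head-below : ℕ → ℕ → ℕ
permutations-with-head-below N r = count (λ f → isPerm? f ×-dec (toℕ (lookup f fzero) <? r)) (allMaps (suc N))

permutations-with-head-below-suc : ∀ N r → r < suc N →
  permutations-with-head-below N (suc r) ≡ permutations-with-head-below N r + count isPerm? (allMaps N)
permutations-with-head-below-suc N r r<1+N =
  trans (count-split _ (λ f → toℕ (lookup f fzero) ℕ.≟ r) (allMaps (suc N)))
        (trans (cong₂ _+_ head≡r head≢r) (+-comm (count isPerm? (allMaps N)) _))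
  where
  q : Fin (suc N)
  q = fromℕ< r<1+N
  head≡r : count (λ f → (isPerm? f ×-dec (toℕ (lookup f fzero) <? suc r)) ×-dec (toℕ (lookup f fzero) ℕ.≟ r))
                 (allMaps (suc N))
           ≡ count isPerm? (allMaps N)
  head≡r = trans (count-≐ _ (λ f → isPerm? f ×-dec (lookup f fzero ≟ q))
                   (λ ((f-perm , _) , f0≡r) → f-perm , toℕ-injective (trans f0≡r (sym (toℕ-fromℕ< r<1+N))))
                   (λ (f-perm , f0≡q) → let f0≡r = trans (cong toℕ f0≡q) (toℕ-fromℕ< r<1+N) in
                     (f-perm , s≤s (≤-reflexive f0≡r)) , f0≡r)
                   (allMaps (suc N)))
                 (permutations-with-head q)
  head≢r : count (λ f → (isPerm? f ×-dec (toℕ (lookup f fzero) <? suc r)) ×-dec ¬? (toℕ (lookup f fzero) ℕ.≟ r))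
                 (allMaps (suc N))
           ≡ permutations-with-head-below N r
  head≢r = count-≐ _ _ (λ ((f-perm , f0<1+r) , f0≢r) → f-perm , ≤∧≢⇒< (ℕ.s≤s⁻¹ f0<1+r) f0≢r)
                       (λ (f-perm , f0<r) → (f-perm , m≤n⇒m≤1+n f0<r) , λ f0≡r → <-irrefl f0≡r f0<r)
                       (allMaps (suc N))

permutations-with-head-below-count : ∀ N r → r ≤ suc N →
  permutations-with-head-below N r ≡ r * count isPerm? (allMaps N)
permutations-with-head-below-count N zero    _      = count-none _ (λ { _ (_ , ()) }) (allMaps (suc N))
permutations-with-head-below-count N (suc r) r<1+N =
  trans (permutations-with-head-below-suc N r r<1+N)
        (trans (cong (_+ count isPerm? (allMaps N)) (permutations-with-head-below-count N r (<⇒≤ r<1+N)))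
               (+-comm (r * count isPerm? (allMaps N)) _))

permutation-count : ∀ n → count isPerm? (allMaps n) ≡ n !
permutation-count zero    = refl
permutation-count (suc N) = begin
  count isPerm? (allMaps (suc N))             ≡⟨ count-≐ _ _ (λ f-perm → f-perm , toℕ<n _) proj₁ (allMaps (suc N)) ⟩
  permutations-with-head-below N (suc N)      ≡⟨ permutations-with-head-below-count N (suc N) ≤-refl ⟩
  suc N * count isPerm? (allMaps N)           ≡⟨ cong (suc N *_) (permutation-count N) ⟩
  suc N * N !                                 ∎

IsEquivalenceᵇ : {X : Set} → (X → X → Bool) → Set
IsEquivalenceᵇ {X} R = ((i : X) → R i i ≡ true) × ((i j : X) → R i j ≡ true → R j i ≡ true) ×
  ((i j l : X) → R i j ≡ true → R j l ≡ true → R i l ≡ true)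

module _ {X : Set} {R : X → X → Bool} where

  IsEquivalenceᵇ-sym : IsEquivalenceᵇ R → ∀ a b → R a b ≡ R b a
  IsEquivalenceᵇ-sym (_ , sym′ , _) a b with R a b in ab | R b a in ba
  ... | true  | true  = refl
  ... | false | false = refl
  ... | true  | false = trans (sym (sym′ a b ab)) ba
  ... | false | true  = trans (sym ab) (sym′ b a ba)

  IsEquivalenceᵇ-row : IsEquivalenceᵇ R → ∀ {a b} z → R a b ≡ true → R a z ≡ R b z
  IsEquivalenceᵇ-row (_ , sym′ , trans′) {a} {b} z ab with R a z in az | R b z in bz
  ... | true  | true  = refl
  ... | false | false = refl
  ... | true  | false = trans (sym (trans′ b a z (sym′ a b ab) az)) bz
  ... | false | true  = trans (sym az) (trans′ a b z ab bz)

  IsEquivalenceᵇ-column : IsEquivalenceᵇ R → ∀ {a b} z → R a b ≡ true → R z a ≡ R z b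
  IsEquivalenceᵇ-column equiv {a} {b} z ab =
    trans (IsEquivalenceᵇ-sym equiv z a) (trans (IsEquivalenceᵇ-row equiv z ab) (IsEquivalenceᵇ-sym equiv b z))

IsEquivalenceᵇ-pullback : {X Y : Set} {R : X → X → Bool} → IsEquivalenceᵇ R → (σ : Y → X) →
  IsEquivalenceᵇ (λ a b → R (σ a) (σ b))
IsEquivalenceᵇ-pullback (r , s , t) σ = (λ i → r (σ i)) , (λ i j → s (σ i) (σ j)) , (λ i j l → t (σ i) (σ j) (σ l))

IsEquivalenceᵇ-≗ : {X : Set} {R S : X → X → Bool} → IsEquivalenceᵇ R → (∀ i j → S i j ≡ R i j) → IsEquivalenceᵇ S
IsEquivalenceᵇ-≗ (r , s , t) S≡R =
  (λ i → trans (S≡R i i) (r i)) ,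
  (λ i j h → trans (S≡R j i) (s i j (trans (sym (S≡R i j)) h))) ,
  (λ i j l h₁ h₂ → trans (S≡R i l) (t i j l (trans (sym (S≡R i j)) h₁) (trans (sym (S≡R j l)) h₂)))

Matrix : ℕ → Set
Matrix n = Vec (Vec Bool n) n

entry : {n : ℕ} → Matrix n → Fin n → Fin n → Bool
entry r i j = lookup (lookup r i) j

tabulate² : {n : ℕ} → (Fin n → Fin n → Bool) → Matrix n
tabulate² R = tabulate λ i → tabulate (R i)

entry-tabulate² : {n : ℕ} (R : Fin n → Fin n → Bool) (i j : Fin n) → entry (tabulate² R) i j ≡ R i j
entry-tabulate² R i j rewrite lookup∘tabulate (λ i → tabulate (R i)) i = lookup∘tabulate (R i) j

tabulate²-isEquivRel : {n : ℕ} {R : Fin n → Fin n → Bool} → IsEquivalenceᵇ R → IsEquivRel (tabulate² R)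
tabulate²-isEquivRel {R = R} equiv = IsEquivalenceᵇ-≗ equiv (entry-tabulate² R)

entry-ext : {n : ℕ} {r r′ : Matrix n} → (∀ i j → entry r i j ≡ entry r′ i j) → r ≡ r′
entry-ext eq = lookup-ext λ i → lookup-ext (eq i)

punchOutMaybe : {N : ℕ} (P : Fin (suc N)) → Fin (suc N) → Maybe (Fin N)
punchOutMaybe P x with P ≟ x
... | yes _   = nothing
... | no  P≢x = just (punchOut P≢x)

module _ {N : ℕ} (P : Fin (suc N)) where

  punchOutMaybe-at : punchOutMaybe P P ≡ nothing
  punchOutMaybe-at with P ≟ P
  ... | yes _   = refl
  ... | no  P≢P = ⊥-elim (P≢P refl)

  punchOutMaybe-punchIn : ∀ i → punchOutMaybe P (punchIn P i) ≡ just i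
  punchOutMaybe-punchIn i with P ≟ punchIn P i
  ... | yes P≡ = ⊥-elim (punchInᵢ≢i P i (sym P≡))
  ... | no  P≢ = cong just (trans (punchOut-cong P refl) (punchOut-punchIn P))

  restrictᴹ : Matrix (suc N) → Matrix N
  restrictᴹ r = tabulate² λ a b → entry r (punchIn P a) (punchIn P b)

  entry-restrictᴹ : ∀ r a b → entry (restrictᴹ r) a b ≡ entry r (punchIn P a) (punchIn P b)
  entry-restrictᴹ r = entry-tabulate² λ a b → entry r (punchIn P a) (punchIn P b)

  restrictᴹ-isEquivRel : ∀ r → IsEquivRel r → IsEquivRel (restrictᴹ r)
  restrictᴹ-isEquivRel r equiv = tabulate²-isEquivRel (IsEquivalenceᵇ-pullback equiv (punchIn P))

withIsolated : {N : ℕ} → Matrix N → Maybe (Fin N) → Maybe (Fin N) → Bool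
withIsolated r nothing  nothing  = true
withIsolated r nothing  (just _) = false
withIsolated r (just _) nothing  = false
withIsolated r (just i) (just j) = entry r i j

withIsolated-isEquivalence : {N : ℕ} {r : Matrix N} → IsEquivRel r → IsEquivalenceᵇ (withIsolated r)
withIsolated-isEquivalence {r = r} (r-refl , r-sym , r-trans) = refl′ , sym′ , trans′
  where
  refl′ : ∀ i → withIsolated r i i ≡ true
  refl′ nothing  = refl
  refl′ (just i) = r-refl i
  sym′ : ∀ i j → withIsolated r i j ≡ true → withIsolated r j i ≡ true
  sym′ nothing  nothing  h = h
  sym′ (just i) (just j) h = r-sym i j h
  trans′ : ∀ i j l → withIsolated r i j ≡ true → withIsolated r j l ≡ true → withIsolated r i l ≡ true
  trans′ nothing  nothing  nothing  _  _  = refl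
  trans′ nothing  nothing  (just _) _  h₂ = h₂
  trans′ (just _) nothing  nothing  h₁ _  = h₁
  trans′ (just i) (just j) (just l) h₁ h₂ = r-trans i j l h₁ h₂

module _ {N : ℕ} (P : Fin (suc N)) where

  isolate : Matrix N → Matrix (suc N)
  isolate r = tabulate² λ x y → withIsolated r (punchOutMaybe P x) (punchOutMaybe P y)

  entry-isolate : ∀ r x y → entry (isolate r) x y ≡ withIsolated r (punchOutMaybe P x) (punchOutMaybe P y)
  entry-isolate r = entry-tabulate² λ x y → withIsolated r (punchOutMaybe P x) (punchOutMaybe P y)

  restrictᴹ-isolate : ∀ r → restrictᴹ P (isolate r) ≡ r
  restrictᴹ-isolate r = entry-ext λ a b → begin
    entry (restrictᴹ P (isolate r)) a b
      ≡⟨ entry-restrictᴹ P (isolate r) a b ⟩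
    entry (isolate r) (punchIn P a) (punchIn P b)
      ≡⟨ entry-isolate r (punchIn P a) (punchIn P b) ⟩
    withIsolated r (punchOutMaybe P (punchIn P a)) (punchOutMaybe P (punchIn P b))
      ≡⟨ cong₂ (withIsolated r) (punchOutMaybe-punchIn P a) (punchOutMaybe-punchIn P b) ⟩
    entry r a b ∎

  isolate-restrictᴹ : ∀ r → IsEquivRel r → (∀ a → entry r (punchIn P a) P ≡ false) → isolate (restrictᴹ P r) ≡ r
  isolate-restrictᴹ r equiv@(r-refl , _) apart = entry-ext agree
    where
    agree : ∀ x y → entry (isolate (restrictᴹ P r)) x y ≡ entry r x y
    agree x y rewrite entry-isolate (restrictᴹ P r) x y with punchView P x | punchView P y
    ... | at       | at       rewrite punchOutMaybe-at P = sym (r-refl P)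
    ... | at       | beside b rewrite punchOutMaybe-at P | punchOutMaybe-punchIn P b =
          sym (trans (IsEquivalenceᵇ-sym equiv P (punchIn P b)) (apart b))
    ... | beside a | at       rewrite punchOutMaybe-at P | punchOutMaybe-punchIn P a = sym (apart a)
    ... | beside a | beside b rewrite punchOutMaybe-punchIn P a | punchOutMaybe-punchIn P b =
          entry-restrictᴹ P r a b

ApartFromLast : (N p : ℕ) → Matrix (suc N) → Set
ApartFromLast N p r = ∀ i → p ≤ toℕ i → toℕ i < N → entry r i (fromℕ N) ≡ false

apartFromLast? : (N p : ℕ) → Decidable (ApartFromLast N p)
apartFromLast? N p r = all? λ i → (p ≤? toℕ i) →-dec ((toℕ i <? N) →-dec (entry r i (fromℕ N) ≟ᵇ false))

lastApart : ℕ → ℕ → ℕ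
lastApart N p = count (λ r → isEquivRel? r ×-dec apartFromLast? N p r) (allRels (suc N))

lastApart-diagonal : ∀ N → lastApart N N ≡ B (suc N)
lastApart-diagonal N = count-≐ _ _ proj₁ (λ equiv → equiv , λ i N≤i i<N → ⊥-elim (<-irrefl refl (≤-<-trans N≤i i<N)))
                                (allRels (suc N))

toℕ-punchIn-last : ∀ {N} (a : Fin N) → toℕ (punchIn (fromℕ N) a) < N
toℕ-punchIn-last {N} a =
  subst (_< N) (sym (toℕ-punchIn-< (fromℕ N) a (subst (toℕ a <_) (sym (toℕ-fromℕ N)) (toℕ<n a)))) (toℕ<n a)

lastApart-zero : ∀ N → lastApart N 0 ≡ B N
lastApart-zero N = sym (count-bijection _ _ (allRels-isEnumeration N) (allRels-isEnumeration (suc N))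
  (isolate last) isolate-injective forward backward)
  where
  last : Fin (suc N)
  last = fromℕ N
  isolate-injective : ∀ {r r′} → isolate last r ≡ isolate last r′ → r ≡ r′
  isolate-injective {r} {r′} eq =
    trans (sym (restrictᴹ-isolate last r)) (trans (cong (restrictᴹ last) eq) (restrictᴹ-isolate last r′))
  forward : ∀ r → IsEquivRel r → IsEquivRel (isolate last r) × ApartFromLast N 0 (isolate last r)
  forward r equiv = tabulate²-isEquivRel (IsEquivalenceᵇ-pullback (withIsolated-isEquivalence equiv) (punchOutMaybe last))
                  , apart
    where
    apart : ApartFromLast N 0 (isolate last r)
    apart i _ i<N rewrite entry-isolate last r i last with punchView last i
    ... | at       = ⊥-elim (<-irrefl (toℕ-fromℕ N) i<N)
    ... | beside a rewrite punchOutMaybe-punchIn last a | punchOutMaybe-at last = refl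
  backward : ∀ r → IsEquivRel r × ApartFromLast N 0 r → ∃ λ r′ → IsEquivRel r′ × isolate last r′ ≡ r
  backward r (equiv , apart) = restrictᴹ last r , restrictᴹ-isEquivRel last r equiv
    , isolate-restrictᴹ last r equiv (λ a → apart (punchIn last a) z≤n (toℕ-punchIn-last a))

module LastApartStep (N p : ℕ) (p≤N : p ≤ N) where

  P : Fin (suc (suc N))
  P = fromℕ< (s≤s (m≤n⇒m≤1+n p≤N))

  toℕ-P : toℕ P ≡ p
  toℕ-P = toℕ-fromℕ< (s≤s (m≤n⇒m≤1+n p≤N))

  punchIn-P-last : punchIn P (fromℕ N) ≡ fromℕ (suc N)
  punchIn-P-last = toℕ-injective (begin
    toℕ (punchIn P (fromℕ N))  ≡⟨ toℕ-punchIn-≥ P (fromℕ N) (subst₂ _≤_ (sym toℕ-P) (sym (toℕ-fromℕ N)) p≤N) ⟩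
    suc (toℕ (fromℕ N))        ≡⟨ cong suc (toℕ-fromℕ N) ⟩
    suc N                      ≡⟨ toℕ-fromℕ (suc N) ⟨
    toℕ (fromℕ (suc N))        ∎)

  σ : Fin (suc (suc N)) → Fin (suc N)
  σ x = fromMaybe (fromℕ N) (punchOutMaybe P x)

  σ-P : σ P ≡ fromℕ N
  σ-P = cong (fromMaybe (fromℕ N)) (punchOutMaybe-at P)

  σ-punchIn : ∀ a → σ (punchIn P a) ≡ a
  σ-punchIn a = cong (fromMaybe (fromℕ N)) (punchOutMaybe-punchIn P a)

  σ-last : σ (fromℕ (suc N)) ≡ fromℕ N
  σ-last = trans (cong σ (sym punchIn-P-last)) (σ-punchIn (fromℕ N))

  glue : Matrix (suc N) → Matrix (suc (suc N))
  glue r = tabulate² λ x y → entry r (σ x) (σ y)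

  entry-glue : ∀ r x y → entry (glue r) x y ≡ entry r (σ x) (σ y)
  entry-glue r = entry-tabulate² λ x y → entry r (σ x) (σ y)

  restrictᴹ-glue : ∀ r → restrictᴹ P (glue r) ≡ r
  restrictᴹ-glue r = entry-ext λ a b →
    trans (entry-restrictᴹ P (glue r) a b)
          (trans (entry-glue r (punchIn P a) (punchIn P b)) (cong₂ (entry r) (σ-punchIn a) (σ-punchIn b)))

  Joined : Matrix (suc (suc N)) → Set
  Joined r = entry r P (fromℕ (suc N)) ≡ true

  glue-apart : ∀ r → ApartFromLast N p r → ApartFromLast (suc N) (suc p) (glue r)
  glue-apart r apart i p<i i<1+N rewrite entry-glue r i (fromℕ (suc N)) | σ-last with punchView P i
  ... | at       = ⊥-elim (<-irrefl (sym toℕ-P) p<i)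
  ... | beside a with p ≤? toℕ a
  ...   | no  p≰a = ⊥-elim (<-asym (subst₂ _<_ (sym toℕ-P) (toℕ-punchIn-< P a a<P) p<i) a<P)
    where
    a<P : toℕ a < toℕ P
    a<P = subst (toℕ a <_) (sym toℕ-P) (≰⇒> p≰a)
  ...   | yes p≤a rewrite σ-punchIn a =
    apart a p≤a (ℕ.s≤s⁻¹ (subst (_< suc N) (toℕ-punchIn-≥ P a (subst (_≤ toℕ a) (sym toℕ-P) p≤a)) i<1+N))

  restrictᴹ-apart : ∀ r → ApartFromLast (suc N) (suc p) r → ApartFromLast N p (restrictᴹ P r)
  restrictᴹ-apart r apart a p≤a a<N = begin
    entry (restrictᴹ P r) a (fromℕ N)              ≡⟨ entry-restrictᴹ P r a (fromℕ N) ⟩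
    entry r (punchIn P a) (punchIn P (fromℕ N))    ≡⟨ cong (entry r (punchIn P a)) punchIn-P-last ⟩
    entry r (punchIn P a) (fromℕ (suc N))          ≡⟨ apart (punchIn P a) (subst (suc p ≤_) (sym a′≡) (s≤s p≤a))
                                                                         (subst (_< suc N) (sym a′≡) (s≤s a<N)) ⟩
    false                                          ∎
    where
    a′≡ : toℕ (punchIn P a) ≡ suc (toℕ a)
    a′≡ = toℕ-punchIn-≥ P a (subst (_≤ toℕ a) (sym toℕ-P) p≤a)

  -- Every x is related to punchIn P (σ x), so entries may be read through σ.
  glue-restrictᴹ : ∀ r → IsEquivRel r → Joined r → glue (restrictᴹ P r) ≡ r
  glue-restrictᴹ r equiv joined = entry-ext λ x y → begin
    entry (glue (restrictᴹ P r)) x y     ≡⟨ entry-glue (restrictᴹ P r) x y ⟩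
    entry (restrictᴹ P r) (σ x) (σ y)    ≡⟨ entry-restrictᴹ P r (σ x) (σ y) ⟩
    entry r (g x) (g y)                  ≡⟨ IsEquivalenceᵇ-row equiv (g y) (related x) ⟨
    entry r x (g y)                      ≡⟨ IsEquivalenceᵇ-column equiv x (related y) ⟨
    entry r x y                          ∎
    where
    g : Fin (suc (suc N)) → Fin (suc (suc N))
    g x = punchIn P (σ x)
    related : ∀ x → entry r x (g x) ≡ true
    related x with punchView P x
    ... | at       = subst (λ z → entry r P z ≡ true) (trans (sym punchIn-P-last) (cong (punchIn P) (sym σ-P))) joined
    ... | beside a = subst (λ z → entry r (punchIn P a) (punchIn P z) ≡ true) (sym (σ-punchIn a)) (proj₁ equiv _)

  joined-count : count (λ r → (isEquivRel? r ×-dec apartFromLast? (suc N) (suc p) r) ×-dec (entry r P (fromℕ (suc N)) ≟ᵇ true))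
                       (allRels (suc (suc N)))
               ≡ lastApart N p
  joined-count = sym (count-bijection _ _ (allRels-isEnumeration (suc N)) (allRels-isEnumeration (suc (suc N)))
    glue glue-injective forward backward)
    where
    glue-injective : ∀ {r r′} → glue r ≡ glue r′ → r ≡ r′
    glue-injective {r} {r′} eq = trans (sym (restrictᴹ-glue r)) (trans (cong (restrictᴹ P) eq) (restrictᴹ-glue r′))
    forward : ∀ r → IsEquivRel r × ApartFromLast N p r →
              (IsEquivRel (glue r) × ApartFromLast (suc N) (suc p) (glue r)) × Joined (glue r)
    forward r (equiv , apart) = (tabulate²-isEquivRel (IsEquivalenceᵇ-pullback equiv σ) , glue-apart r apart)
      , trans (entry-glue r P (fromℕ (suc N))) (trans (cong₂ (entry r) σ-P σ-last) (proj₁ equiv (fromℕ N)))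
    backward : ∀ r → (IsEquivRel r × ApartFromLast (suc N) (suc p) r) × Joined r →
               ∃ λ r′ → (IsEquivRel r′ × ApartFromLast N p r′) × glue r′ ≡ r
    backward r ((equiv , apart) , joined) =
      restrictᴹ P r , (restrictᴹ-isEquivRel P r equiv , restrictᴹ-apart r apart) , glue-restrictᴹ r equiv joined

  apart-from-P : ∀ {r} → ApartFromLast (suc N) (suc p) r → ¬ Joined r → ApartFromLast (suc N) p r
  apart-from-P apart unjoined i p≤i i<1+N with toℕ i ℕ.≟ p
  ... | yes i≡p rewrite toℕ-injective {i = i} {j = P} (trans i≡p (sym toℕ-P)) = ¬-not unjoined
  ... | no  i≢p = apart i (≤∧≢⇒< p≤i (i≢p ∘ sym)) i<1+N

  unjoined-count : count (λ r → (isEquivRel? r ×-dec apartFromLast? (suc N) (suc p) r) ×-dec ¬? (entry r P (fromℕ (suc N)) ≟ᵇ true))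
                         (allRels (suc (suc N)))
                 ≡ lastApart (suc N) p
  unjoined-count = count-≐ _ _
    (λ {r} ((equiv , apart) , unjoined) → equiv , apart-from-P {r} apart unjoined)
    (λ (equiv , apart) → (equiv , (λ i p<i → apart i (<⇒≤ p<i))) ,
       λ joined → not-¬ (apart P (≤-reflexive (sym toℕ-P)) (subst (_< suc N) (sym toℕ-P) (s≤s p≤N))) joined)
    (allRels (suc (suc N)))

lastApart-pascal : PascalRecurrence lastApart
lastApart-pascal N p p≤N =
  trans (count-split _ (λ r → entry r P (fromℕ (suc N)) ≟ᵇ true) (allRels (suc (suc N))))
        (trans (cong₂ _+_ joined-count unjoined-count) (+-comm (lastApart N p) _))
  where open LastApartStep N p p≤N

⋆-transfer : ∀ {q i x y : ℕ → ℕ} → i ≗ 𝟏 ⋆ q → x ≗ 𝟏 ⋆ y → q ⋆ x ≗ i ⋆ y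
⋆-transfer {q} {i} {x} {y} i≗ x≗ n = begin
  (q ⋆ x) n          ≡⟨ ⋆-congʳ q x≗ n ⟩
  (q ⋆ (𝟏 ⋆ y)) n    ≡⟨ ⋆-exchange q y n ⟩
  ((𝟏 ⋆ q) ⋆ y) n    ≡⟨ ⋆-congˡ y i≗ n ⟨
  (i ⋆ y) n          ∎

permutations-extensionClosed : ExtensionClosed IsPerm
permutations-extensionClosed = record
  { 𝒞? = isPerm? ; 𝒞⇒perm = λ f-perm → f-perm
  ; 𝒞-extend⁺ = λ p → extend-preserves-perm p p ; 𝒞-extend⁻ = λ p → extend-reflects-perm p p }

involutions-extensionClosed : ExtensionClosed IsInvolution
involutions-extensionClosed = record
  { 𝒞? = isInvolution? ; 𝒞⇒perm = proj₁
  ; 𝒞-extend⁺ = extend-preserves-involution ; 𝒞-extend⁻ = extend-reflects-involution }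

module Permutations = FixedPointCounts permutations-extensionClosed
module Involutions  = FixedPointCounts involutions-extensionClosed

Q≡tailFree : ∀ m k → Q (m + k) m ≡ Involutions.tailFree (m + k) m
Q≡tailFree m k with m <? suc (m + k)
... | yes m<1+m+k = trans (Involutions.largestFixedPoint-count (fromℕ< m<1+m+k))
                         (cong (Involutions.tailFree (m + k)) (toℕ-fromℕ< m<1+m+k))
... | no  m≮1+m+k = ⊥-elim (m≮1+m+k (s≤s (m≤m+n m k)))

factorial≗𝟏⋆D : _! ≗ 𝟏 ⋆ D
factorial≗𝟏⋆D n = begin
  n !                                      ≡⟨ permutation-count n ⟨
  count isPerm? (allMaps n)                ≡⟨ Permutations.tailFree-diagonal n ⟨
  Permutations.tailFree n n                ≡⟨ diagonal≡𝟏⋆column Permutations.tailFree Permutations.tailFree-pascal 0 n ⟩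
  (𝟏 ⋆ λ k → Permutations.tailFree k 0) n  ≡⟨ ⋆-congʳ 𝟏 Permutations.tailFree-zero n ⟩
  (𝟏 ⋆ D) n                                ∎

involutions≗𝟏⋆M : I ≗ 𝟏 ⋆ M
involutions≗𝟏⋆M n = begin
  I n                                     ≡⟨ Involutions.tailFree-diagonal n ⟨
  Involutions.tailFree n n                ≡⟨ diagonal≡𝟏⋆column Involutions.tailFree Involutions.tailFree-pascal 0 n ⟩
  (𝟏 ⋆ λ k → Involutions.tailFree k 0) n  ≡⟨ ⋆-congʳ 𝟏 Involutions.tailFree-zero n ⟩
  (𝟏 ⋆ M) n                               ∎

involutions≗𝟏⋆Q : ∀ m → (λ k → I (m + k)) ≗ 𝟏 ⋆ (λ k → Q (m + k) m)
involutions≗𝟏⋆Q m k = begin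
  I (m + k)                                       ≡⟨ Involutions.tailFree-diagonal (m + k) ⟨
  Involutions.tailFree (m + k) (m + k)            ≡⟨ diagonal≡𝟏⋆column Involutions.tailFree Involutions.tailFree-pascal m k ⟩
  (𝟏 ⋆ λ j → Involutions.tailFree (m + j) m) k    ≡⟨ ⋆-congʳ 𝟏 (sym ∘ Q≡tailFree m) k ⟩
  (𝟏 ⋆ λ j → Q (m + j) m) k                       ∎

bell-suc≗𝟏⋆B : B ∘ suc ≗ 𝟏 ⋆ B
bell-suc≗𝟏⋆B n = begin
  B (suc n)                    ≡⟨ lastApart-diagonal n ⟨
  lastApart n n                ≡⟨ diagonal≡𝟏⋆column lastApart lastApart-pascal 0 n ⟩
  (𝟏 ⋆ λ k → lastApart k 0) n  ≡⟨ ⋆-congʳ 𝟏 lastApart-zero n ⟩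
  (𝟏 ⋆ B) n                    ∎

corollary4p4 : (n m : ℕ) →
    (sumTo n (λ k → (n C k) * Q (m + k) m * (n ∸ k) !)
      ≡ sumTo n (λ k → (n C k) * I (m + k) * D (n ∸ k)))
  × (sumTo n (λ k → (n C k) * Q (m + k) m * I (n ∸ k))
      ≡ sumTo n (λ k → (n C k) * I (m + k) * M (n ∸ k)))
  × (sumTo n (λ k → (n C k) * Q (m + k) m * B (suc (n ∸ k)))
      ≡ sumTo n (λ k → (n C k) * I (m + k) * B (n ∸ k)))
corollary4p4 n m = transfer factorial≗𝟏⋆D , transfer involutions≗𝟏⋆M , transfer bell-suc≗𝟏⋆B
  where
  transfer : ∀ {x y : ℕ → ℕ} → x ≗ 𝟏 ⋆ y →
    sumTo n (λ k → (n C k) * Q (m + k) m * x (n ∸ k)) ≡ sumTo n (λ k → (n C k) * I (m + k) * y (n ∸ k))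
  transfer {x} {y} x≗ = begin
    sumTo n (λ k → (n C k) * Q (m + k) m * x (n ∸ k))   ≡⟨ sumTo≡sum< n _ ⟩
    ((λ k → Q (m + k) m) ⋆ x) n                         ≡⟨ ⋆-transfer (involutions≗𝟏⋆Q m) x≗ n ⟩
    ((λ k → I (m + k)) ⋆ y) n                           ≡⟨ sumTo≡sum< n _ ⟨
    sumTo n (λ k → (n C k) * I (m + k) * y (n ∸ k))     ∎
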